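{- Let $\Gamma$ be an infinite torsion-free abelian group and $F\colon\Gamma\to\Gamma$ an injective endomorphism, and suppose $\Gamma$ admits an $F^r$-spanning set for some $r>0$. Then in the ring $\mathbb{Z}[F]$ one has $\bigcap_{i\in\mathbb{N}}(F^i)=\{0\}$, where $(F^i)$ is the ideal of $\mathbb{Z}[F]$ generated by $F^i$.
   Context: $\mathbb{Z}[F]$ denotes the subring of the endomorphism ring of $\Gamma$ generated by $F$. For a string $\sigma=s_0\cdots s_n$ of elements of $\Gamma$ and an endomorphism $G$, $[\sigma]_G=s_0+Gs_1+\cdots+G^ns_n$. $\Lambda^*$ denotes finite strings over $\Lambda$. A finite $\Sigma\subseteq\Gamma$ is a $G$-spanning set if: (i) every $a\in\Gamma$ equals $[\sigma]_G$ for some $\sigma\in\Sigma^*$; (ii) $0\in\Sigma$ and $\Sigma=-\Sigma$; (iii) for $a_1,\dots,a_5\in\Sigma$, $a_1+\cdots+a_5\in\Sigma+G\Sigma$; (iv) if $a_1,a_2,a_3\in\Sigma$ and $a_1+a_2+a_3\in G\Gamma$ then $a_1+a_2+a_3\in G\Sigma$. -}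

module Defs where

open import Level using (_⊔_)
open import Data.Nat using (ℕ; zero; suc)
open import Data.Integer using (ℤ; +_; -[1+_])
open import Data.List using (List; []; _∷_)
open import Data.List.Relation.Unary.All using (All)
open import Data.List.Relation.Unary.Any using (Any)
open import Data.Product using (Σ; ∃; _×_; _,_)
open import Relation.Nullary using (¬_)
open import Algebra.Bundles using (AbelianGroup)

module _ {c ℓ} (Γ : AbelianGroup c ℓ) where
  open AbelianGroup Γ renaming (_∙_ to _+_; ε to 0#; _⁻¹ to -_)

  _·ℕ_ : ℕ → Carrier → Carrier
  zero ·ℕ a = 0#
  suc n ·ℕ a = a + (n ·ℕ a)

  _·ℤ_ : ℤ → Carrier → Carrier
  (+ n) ·ℤ a = n ·ℕ a
  -[1+ n ] ·ℤ a = - (suc n ·ℕ a)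

  Infinite : Set (c ⊔ ℓ)
  Infinite = (xs : List Carrier) → ∃ λ a → All (λ x → ¬ (a ≈ x)) xs

  TorsionFree : Set (c ⊔ ℓ)
  TorsionFree = ∀ (n : ℕ) (a : Carrier) → (suc n ·ℕ a) ≈ 0# → a ≈ 0#

  record Endomorphism : Set (c ⊔ ℓ) where
    field
      fun   : Carrier → Carrier
      cong  : ∀ {a b} → a ≈ b → fun a ≈ fun b
      hom   : ∀ a b → fun (a + b) ≈ fun a + fun b

  Injective : (Carrier → Carrier) → Set (c ⊔ ℓ)
  Injective f = ∀ {a b} → f a ≈ f b → a ≈ b

  _^_ : (Carrier → Carrier) → ℕ → Carrier → Carrier
  (f ^ zero) a = a
  (f ^ suc n) a = f ((f ^ n) a)

  -- [σ]_G = s₀ + G s₁ + ... + Gⁿ sₙ   (Horner form)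
  ⟦_⟧ : List Carrier → (Carrier → Carrier) → Carrier
  ⟦ [] ⟧ G = 0#
  ⟦ s ∷ σ ⟧ G = s + G (⟦ σ ⟧ G)

  _∈_ : Carrier → List Carrier → Set (c ⊔ ℓ)
  a ∈ xs = Any (a ≈_) xs

  record IsSpanningSet (G : Carrier → Carrier) (S : List Carrier) : Set (c ⊔ ℓ) where
    field
      span    : ∀ a → ∃ λ (σ : List Carrier) → All (_∈ S) σ × ⟦ σ ⟧ G ≈ a
      zero∈   : 0# ∈ S
      neg∈    : ∀ a → a ∈ S → (- a) ∈ S
      sum5    : ∀ a₁ a₂ a₃ a₄ a₅ → a₁ ∈ S → a₂ ∈ S → a₃ ∈ S → a₄ ∈ S → a₅ ∈ S →
                ∃ λ b → ∃ λ b' → b ∈ S × b' ∈ S ×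
                  (a₁ + (a₂ + (a₃ + (a₄ + a₅)))) ≈ b + G b'
      sum3    : ∀ a₁ a₂ a₃ → a₁ ∈ S → a₂ ∈ S → a₃ ∈ S →
                (∃ λ x → (a₁ + (a₂ + a₃)) ≈ G x) →
                ∃ λ b → b ∈ S × (a₁ + (a₂ + a₃)) ≈ G b

  -- element of ℤ[F] given by coefficient list [c₀,…,cₙ] : the endomorphism
  -- a ↦ c₀a + F(c₁a) + … + Fⁿ(cₙa)  (= (c₀ + c₁F + … + cₙFⁿ)(a))
  polyEval : (Carrier → Carrier) → List ℤ → Carrier → Carrier
  polyEval F [] a = 0#
  polyEval F (k ∷ ks) a = (k ·ℤ a) + F (polyEval F ks a)

  InIdeal : (F : Carrier → Carrier) → ℕ → List ℤ → Set (c ⊔ ℓ)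
  InIdeal F i p = ∃ λ (q : List ℤ) → ∀ a → polyEval F p a ≈ (F ^ i) (polyEval F q a)

{-# OPTIONS --safe #-}
-- Put G = F^(r+1). An element of ⋂ (Fⁱ) sends every a to an element divisible by
-- every power of G. Writing a = [σ]_G with digits σ in the spanning set S, axiom (iv)
-- lets us peel off one digit at a time from a = Gᵐ x, carrying a single digit of S
-- along; once all digits of σ are used up the quotient x itself lies in S. So the
-- quotients of a by high powers of G lie in the finite set S, and by the pigeonhole
-- principle and injectivity one of them satisfies G^(k+1) y = y. Every multiple n·y
-- is G^(k+1)-periodic too, hence lies in S; a second pigeonhole argument and
-- torsion-freeness give y = 0, so a = 0.
module Submission where

open import Defs
open import Data.Nat using (ℕ; suc)
open import Data.List using (List)
open import Data.Integer using (ℤ)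
open import Data.Product using (∃)
open import Algebra.Bundles using (AbelianGroup)

open import Level using (_⊔_)
import Data.Nat as Nat
open Nat using (zero; _*_; _≤_; z≤n; s≤s)
open import Data.Nat.Properties using (+-suc; +-assoc; n<1+n; m≤m+n; m≤m*n; m≤n⇒∃[o]m+o≡n)
open import Data.List using ([]; _∷_; length; lookup)
open import Data.List.Relation.Unary.All using (All; []; _∷_)
open import Data.List.Relation.Unary.Any as Any using ()
open import Data.List.Relation.Unary.Any.Properties using (lookup-index)
open import Data.Fin using (toℕ)
open import Data.Fin.Properties using (pigeonhole)
open import Data.Product using (∃₂; _×_; _,_; proj₁; proj₂)
import Relation.Binary.PropositionalEquality as ≡

module _ {c ℓ} (Γ : AbelianGroup c ℓ) where
  open AbelianGroup Γ renaming (_∙_ to _+_; ε to 0#; _⁻¹ to -_)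
  open import Algebra.Properties.AbelianGroup Γ
    using (∙-cancelˡ; x≈z//y; identityʳ-unique; inverseʳ-unique)
  open import Relation.Binary.Reasoning.Setoid setoid

  private
    infixr 8 _·_
    _·_ : ℕ → Carrier → Carrier
    _·_ = _·ℕ_ Γ

    _^ⁿ_ : (Carrier → Carrier) → ℕ → Carrier → Carrier
    _^ⁿ_ = _^_ Γ

    [_]_ : List Carrier → (Carrier → Carrier) → Carrier
    [_]_ = ⟦_⟧ Γ

    infix 4 _∈ₗ_
    _∈ₗ_ : Carrier → List Carrier → Set (c ⊔ ℓ)
    _∈ₗ_ = _∈_ Γ

  ·-congʳ : ∀ n {a b} → a ≈ b → n · a ≈ n · b
  ·-congʳ zero    _   = refl
  ·-congʳ (suc n) a≈b = ∙-cong a≈b (·-congʳ n a≈b)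

  ·-homo-+ : ∀ m n a → (m Nat.+ n) · a ≈ m · a + n · a
  ·-homo-+ zero    n a = sym (identityˡ (n · a))
  ·-homo-+ (suc m) n a = trans (∙-congˡ (·-homo-+ m n a)) (sym (assoc a (m · a) (n · a)))

  ∈ₗ-resp-≈ : ∀ {a b S} → a ≈ b → a ∈ₗ S → b ∈ₗ S
  ∈ₗ-resp-≈ a≈b = Any.map (trans (sym a≈b))

  pigeonhole-∈ₗ : ∀ S (h : ℕ → Carrier) → (∀ n → h n ∈ₗ S) →
                  ∃₂ λ i d → h i ≈ h (i Nat.+ suc d)
  pigeonhole-∈ₗ S h h∈S
    with i , j , i<j , same-index ← pigeonhole (n<1+n (length S)) (λ k → Any.index (h∈S (toℕ k)))
    with d , i+1+d≡j ← m≤n⇒∃[o]m+o≡n i<j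
    = toℕ i , d , (begin
      h (toℕ i)                          ≈⟨ lookup-index (h∈S (toℕ i)) ⟩
      lookup S (Any.index (h∈S (toℕ i))) ≡⟨ ≡.cong (lookup S) same-index ⟩
      lookup S (Any.index (h∈S (toℕ j))) ≈⟨ lookup-index (h∈S (toℕ j)) ⟨
      h (toℕ j)                          ≡⟨ ≡.cong h (≡.trans (+-suc (toℕ i) d) i+1+d≡j) ⟨
      h (toℕ i Nat.+ suc d)                ∎)

  multiples-∈ₗ⇒≈0# : TorsionFree Γ → ∀ S y → (∀ n → n · y ∈ₗ S) → y ≈ 0#
  multiples-∈ₗ⇒≈0# torsionFree S y n·y∈S
    with i , d , i·y≈[i+1+d]·y ← pigeonhole-∈ₗ S (_· y) n·y∈S
    = torsionFree d y (∙-cancelˡ (i · y) _ _ (begin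
      i · y + suc d · y   ≈⟨ ·-homo-+ i (suc d) y ⟨
      (i Nat.+ suc d) · y   ≈⟨ i·y≈[i+1+d]·y ⟨
      i · y               ≈⟨ identityʳ (i · y) ⟨
      i · y + 0#          ∎))

  ^ⁿ-+ : ∀ f m n x → (f ^ⁿ (m Nat.+ n)) x ≡.≡ (f ^ⁿ m) ((f ^ⁿ n) x)
  ^ⁿ-+ f zero    n x = ≡.refl
  ^ⁿ-+ f (suc m) n x = ≡.cong f (^ⁿ-+ f m n x)

  ^ⁿ-* : ∀ f m n x → (f ^ⁿ (m * n)) x ≡.≡ ((f ^ⁿ n) ^ⁿ m) x
  ^ⁿ-* f zero    n x = ≡.refl
  ^ⁿ-* f (suc m) n x = ≡.trans (^ⁿ-+ f n (m * n) x) (≡.cong (f ^ⁿ n) (^ⁿ-* f m n x))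

  ^ⁿ-injective : ∀ {f} → Injective Γ f → ∀ n → Injective Γ (f ^ⁿ n)
  ^ⁿ-injective f-injective zero    eq = eq
  ^ⁿ-injective f-injective (suc n) eq = ^ⁿ-injective f-injective n (f-injective eq)

  module _ (G : Endomorphism Γ) where
    open Endomorphism G renaming (fun to g; cong to g-cong; hom to g-hom)

    ε-homo : g 0# ≈ 0#
    ε-homo = identityʳ-unique (g 0#) (g 0#) (trans (sym (g-hom 0# 0#)) (g-cong (identityʳ 0#)))

    ⁻¹-homo : ∀ a → g (- a) ≈ - g a
    ⁻¹-homo a = inverseʳ-unique (g a) (g (- a))
      (trans (sym (g-hom a (- a))) (trans (g-cong (inverseʳ a)) ε-homo))

    ·-homo : ∀ n a → g (n · a) ≈ n · g a
    ·-homo zero    a = ε-homo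
    ·-homo (suc n) a = trans (g-hom a (n · a)) (∙-congˡ (·-homo n a))

    ^ⁿ-cong : ∀ n {a b} → a ≈ b → (g ^ⁿ n) a ≈ (g ^ⁿ n) b
    ^ⁿ-cong zero    a≈b = a≈b
    ^ⁿ-cong (suc n) a≈b = g-cong (^ⁿ-cong n a≈b)

    ^ⁿ-homo : ∀ n a b → (g ^ⁿ n) (a + b) ≈ (g ^ⁿ n) a + (g ^ⁿ n) b
    ^ⁿ-homo zero    a b = refl
    ^ⁿ-homo (suc n) a b = trans (g-cong (^ⁿ-homo n a b)) (g-hom _ _)

    ^ⁿ-fixed : ∀ {x} → g x ≈ x → ∀ n → (g ^ⁿ n) x ≈ x
    ^ⁿ-fixed gx≈x zero    = refl
    ^ⁿ-fixed gx≈x (suc n) = trans (g-cong (^ⁿ-fixed gx≈x n)) gx≈x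

  _^ᴱ_ : Endomorphism Γ → ℕ → Endomorphism Γ
  G ^ᴱ n = record
    { fun  = Endomorphism.fun G ^ⁿ n
    ; cong = ^ⁿ-cong G n
    ; hom  = ^ⁿ-homo G n
    }

  ⋂-ideals⇒divisible : ∀ f p → (∀ i → InIdeal Γ f i p) →
                       ∀ k a m → ∃ λ x → polyEval Γ f p a ≈ ((f ^ⁿ k) ^ⁿ m) x
  ⋂-ideals⇒divisible f p p∈⋂ k a m =
    let q , p≈fⁱq = p∈⋂ (m * k)
    in polyEval Γ f q a , trans (p≈fⁱq a) (reflexive (^ⁿ-* f m k _))

  module SpanningSet (G : Endomorphism Γ) (g-injective : Injective Γ (Endomorphism.fun G))
                     {S : List Carrier} (spanning : IsSpanningSet Γ (Endomorphism.fun G) S) where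
    open Endomorphism G renaming (fun to g; cong to g-cong; hom to g-hom)
    open IsSpanningSet spanning

    -- By (iv) applied to t, s, 0, the part t + s divisible by g is a single digit g u.
    carry : ∀ {t s w v} → t ∈ₗ S → s ∈ₗ S → t + (s + g w) ≈ g v → ∃ λ u → u ∈ₗ S × u + w ≈ v
    carry {t} {s} {w} {v} t∈S s∈S t+s+gw≈gv =
      let u , u∈S , t+s+0≈gu = sum3 t s 0# t∈S s∈S zero∈ (v + - w , t+s+0≈g[v-w])
      in u , u∈S , g-injective (begin
        g (u + w)            ≈⟨ g-hom u w ⟩
        g u + g w            ≈⟨ ∙-congʳ t+s+0≈gu ⟨
        t + (s + 0#) + g w   ≈⟨ ∙-congʳ (∙-congˡ (identityʳ s)) ⟩
        t + s + g w          ≈⟨ assoc t s (g w) ⟩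
        t + (s + g w)        ≈⟨ t+s+gw≈gv ⟩
        g v                  ∎)
      where
        t+s+0≈g[v-w] : t + (s + 0#) ≈ g (v + - w)
        t+s+0≈g[v-w] = begin
          t + (s + 0#)    ≈⟨ ∙-congˡ (identityʳ s) ⟩
          t + s           ≈⟨ x≈z//y (t + s) (g w) (g v) (trans (assoc t s (g w)) t+s+gw≈gv) ⟩
          g v + - g w     ≈⟨ ∙-congˡ (⁻¹-homo G w) ⟨
          g v + g (- w)   ≈⟨ g-hom v (- w) ⟨
          g (v + - w)     ∎

    quotient-∈ₗ : ∀ m {t x} σ → t ∈ₗ S → All (_∈ₗ S) σ → length σ ≤ m →
                  t + [ σ ] g ≈ (g ^ⁿ m) x → x ∈ₗ S
    quotient-∈ₗ zero    []      t∈S []          z≤n         t≈x =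
      ∈ₗ-resp-≈ (trans (sym (identityʳ _)) t≈x) t∈S
    quotient-∈ₗ (suc m) (s ∷ σ) t∈S (s∈S ∷ σ∈S) (s≤s |σ|≤m) eq =
      let u , u∈S , eq′ = carry t∈S s∈S eq
      in quotient-∈ₗ m σ u∈S σ∈S |σ|≤m eq′
    quotient-∈ₗ (suc m) []      t∈S []          z≤n         eq =
      let u , u∈S , eq′ = carry t∈S zero∈ (trans (∙-congˡ (trans (identityˡ _) (ε-homo G))) eq)
      in quotient-∈ₗ m [] u∈S [] z≤n eq′

    eventual-quotients-∈ₗ : ∀ a → ∃ λ N → ∀ m {x} → N ≤ m → a ≈ (g ^ⁿ m) x → x ∈ₗ S
    eventual-quotients-∈ₗ a =
      let σ , σ∈S , [σ]≈a = span a
      in length σ , λ m N≤m a≈gᵐx →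
           quotient-∈ₗ m σ zero∈ σ∈S N≤m (trans (identityˡ _) (trans [σ]≈a a≈gᵐx))

    periodic⇒∈ₗ : ∀ k {y} → (g ^ⁿ suc k) y ≈ y → y ∈ₗ S
    periodic⇒∈ₗ k {y} periodic =
      let N , bounded = eventual-quotients-∈ₗ y
      in bounded (N * suc k) (m≤m*n N (suc k)) (begin
        y                              ≈⟨ ^ⁿ-fixed (G ^ᴱ suc k) periodic N ⟨
        ((g ^ⁿ suc k) ^ⁿ N) y          ≡⟨ ^ⁿ-* g N (suc k) y ⟨
        (g ^ⁿ (N * suc k)) y           ∎)

    periodic⇒≈0# : TorsionFree Γ → ∀ k {y} → (g ^ⁿ suc k) y ≈ y → y ≈ 0#
    periodic⇒≈0# torsionFree k {y} periodic =
      multiples-∈ₗ⇒≈0# torsionFree S y λ n →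
        periodic⇒∈ₗ k (trans (·-homo (G ^ᴱ suc k) n y) (·-congʳ n periodic))

    module _ {a} (divisible : ∀ m → ∃ λ x → a ≈ (g ^ⁿ m) x) where
      private
        quotient : ℕ → Carrier
        quotient m = proj₁ (divisible m)

        a≈gᵐquotient : ∀ m → a ≈ (g ^ⁿ m) (quotient m)
        a≈gᵐquotient m = proj₂ (divisible m)

      quotient-eventually-periodic : ∃₂ λ n k → (g ^ⁿ suc k) (quotient n) ≈ quotient n
      quotient-eventually-periodic
        with N , bounded ← eventual-quotients-∈ₗ a
        with i , d , same ← pigeonhole-∈ₗ S (λ j → quotient (N Nat.+ j))
                              (λ j → bounded (N Nat.+ j) (m≤m+n N j) (a≈gᵐquotient (N Nat.+ j)))
        = N Nat.+ i , d , sym (^ⁿ-injective g-injective (N Nat.+ i) (begin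
          (g ^ⁿ n) (quotient n)                 ≈⟨ a≈gᵐquotient n ⟨
          a                                     ≈⟨ a≈gᵐquotient n′ ⟩
          (g ^ⁿ n′) (quotient n′)               ≡⟨ ≡.cong (λ e → (g ^ⁿ e) (quotient n′)) (+-assoc N i (suc d)) ⟨
          (g ^ⁿ (n Nat.+ suc d)) (quotient n′)    ≡⟨ ^ⁿ-+ g n (suc d) (quotient n′) ⟩
          (g ^ⁿ n) ((g ^ⁿ suc d) (quotient n′)) ≈⟨ ^ⁿ-cong G n (^ⁿ-cong G (suc d) same) ⟨
          (g ^ⁿ n) ((g ^ⁿ suc d) (quotient n))  ∎))
        where
          n n′ : ℕ
          n  = N Nat.+ i
          n′ = N Nat.+ (i Nat.+ suc d)

      divisible⇒≈0# : TorsionFree Γ → a ≈ 0#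
      divisible⇒≈0# torsionFree =
        let n , k , periodic = quotient-eventually-periodic
        in begin
          a                      ≈⟨ a≈gᵐquotient n ⟩
          (g ^ⁿ n) (quotient n)  ≈⟨ ^ⁿ-cong G n (periodic⇒≈0# torsionFree k periodic) ⟩
          (g ^ⁿ n) 0#            ≈⟨ ε-homo (G ^ᴱ n) ⟩
          0#                     ∎

lemma6p4 : ∀ {c ℓ} (Γ : AbelianGroup c ℓ) (F : Endomorphism Γ) →
    Infinite Γ → TorsionFree Γ → Injective Γ (Endomorphism.fun F) →
    (∃ λ (r : ℕ) → ∃ λ (S : List (AbelianGroup.Carrier Γ)) →
      IsSpanningSet Γ (_^_ Γ (Endomorphism.fun F) (suc r)) S) →
    ∀ (p : List ℤ) → (∀ (i : ℕ) → InIdeal Γ (Endomorphism.fun F) i p) →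
    ∀ a → AbelianGroup._≈_ Γ (polyEval Γ (Endomorphism.fun F) p a) (AbelianGroup.ε Γ)
lemma6p4 Γ F _ torsionFree F-injective (r , S , spanning) p p∈⋂ a =
  divisible⇒≈0# (⋂-ideals⇒divisible Γ (Endomorphism.fun F) p p∈⋂ (suc r) a) torsionFree
  where open SpanningSet Γ (_^ᴱ_ Γ F (suc r)) (^ⁿ-injective Γ F-injective (suc r)) spanning
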